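{- Let $n\ge 2$ and $y=y_1\cdots y_{2n-2}\in\mathsf{Pop}_{\mathrm{Weak}(B_{n-1})}(\mathrm{Weak}(B_{n-1}))$. Then the permutation $x=1\,(y_1+1)(y_2+1)\cdots(y_{2n-2}+1)\,2n$ belongs to $\mathsf{Pop}_{\mathrm{Weak}(B_n)}(\mathrm{Weak}(B_n))$.
   Context: $B_m$ is the set of permutations $x=x_1\cdots x_{2m}$ of $\{1,\dots,2m\}$ with $x_i+x_{2m+1-i}=2m+1$ for all $i$; $\mathrm{Weak}(B_m)$ is $B_m$ with the right weak order ($x\le y$ iff every pair of values $a<b$ with $b$ before $a$ in $x$ also has $b$ before $a$ in $y$). For a finite lattice $M$, $\mathsf{Pop}_M(x)$ is the meet of $x$ and all elements it covers; in $\mathrm{Weak}(B_m)$ this amounts to reversing each maximal descending run of $x$; $\mathsf{Pop}_M(M)$ denotes its image. -}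

module Defs where

open import Data.Nat using (ℕ; zero; suc; _+_; _*_; _<_)
open import Data.List using (List; []; _∷_; _++_; length; lookup; map; upTo)
open import Data.List.Relation.Binary.Permutation.Propositional using (_↭_)
open import Data.Fin using (Fin; toℕ)
open import Data.Product using (Σ; ∃; _×_; _,_)
open import Data.Sum using (_⊎_)
open import Relation.Binary.PropositionalEquality using (_≡_)
open import Relation.Nullary using (¬_)

-- Permutations are one-line notation lists of natural numbers.

IsPerm : ℕ → List ℕ → Set
IsPerm k x = x ↭ map suc (upTo k)

-- The hyperoctahedral group B_m: permutations x of {1,…,2m} with
-- x_i + x_{2m+1-i} = 2m+1 (positions 0-indexed here: i + j + 1 = 2m).
B : ℕ → List ℕ → Set
B m x = IsPerm (2 * m) x ×
        (∀ (i j : Fin (length x)) → toℕ i + toℕ j + 1 ≡ 2 * m →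
          lookup x i + lookup x j ≡ 2 * m + 1)

Before : List ℕ → ℕ → ℕ → Set
Before x b a = ∃ λ l₁ → ∃ λ l₂ → ∃ λ l₃ → x ≡ l₁ ++ b ∷ l₂ ++ a ∷ l₃

-- right weak order: every inversion of x is an inversion of y
_≤W_ : List ℕ → List ℕ → Set
x ≤W y = ∀ a b → a < b → Before x b a → Before y b a

Covers : ℕ → List ℕ → List ℕ → Set
Covers m w x = B m x × B m w × x ≤W w × ¬ (x ≡ w) ×
  (∀ z → B m z → x ≤W z → z ≤W w → z ≡ x ⊎ z ≡ w)

IsMeet : ℕ → (List ℕ → Set) → List ℕ → Set
IsMeet m S y = B m y × (∀ s → S s → y ≤W s) ×
  (∀ z → B m z → (∀ s → S s → z ≤W s) → z ≤W y)

IsPopOf : ℕ → List ℕ → List ℕ → Set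
IsPopOf m w y = IsMeet m (λ z → z ≡ w ⊎ Covers m w z) y

InPopImage : ℕ → List ℕ → Set
InPopImage m y = ∃ λ w → B m w × IsPopOf m w y

{-# OPTIONS --safe #-}
-- In embed m w nothing
-- precedes 1 and nothing follows 2m+2, so every element of Weak(B_{m+1}) below embed m w still
-- starts with 1 and ends with 2m+2, i.e. lies in the image of embed m. Being an order embedding,
-- embed m therefore maps the principal ideal of w isomorphically onto that of embed m w, and it
-- carries the covers of w and the meet defining Pop(w) along: embed m (Pop w) = Pop (embed m w).
module Submission where

open import Defs
open import Data.Nat using (ℕ; zero; suc; _+_; _*_; _∸_; _≤_; _<_; s≤s; z≤n; _≟_)
open import Data.Nat.Properties
  using (*-suc; +-comm; +-suc; +-identityʳ; suc-injective; <-irrefl; <-asym; <⇒≢; ≤-pred; ≤∧≢⇒<;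
         m+1+n≢0; m+1+n≢m; m+1+n≢n)
open import Data.List using (List; _∷_; []; _++_; [_]; map; length; lookup; upTo; applyUpTo)
open import Data.List.Properties
  using (length-map; length-upTo; map-++; ∷-injectiveʳ; ++-cancelʳ; map-injective; ++-identityʳ; upTo-∷ʳ; map-upTo)
open import Data.List.Membership.Propositional using (_∈_)
open import Data.List.Membership.Propositional.Properties
  using (∈-map⁻; ∈-map⁺; ∈-++⁻; ∈-++⁺ˡ; ∈-++⁺ʳ; ∈-∃++; ∈-upTo⁻)
open import Data.List.Relation.Unary.Any using (here; there)
open import Data.List.Relation.Unary.All using (_∷_)
open import Data.List.Relation.Unary.AllPairs using (_∷_)
open import Data.List.Relation.Binary.Permutation.Propositional using (_↭_; prep; ↭-sym; ↭⇒↭ₛ)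
open import Data.List.Relation.Binary.Permutation.Propositional.Properties
  using (∈-resp-↭; map⁺; ↭-map-inv; ++⁺ʳ; drop-mid; ↭-length)
open import Data.List.Relation.Binary.Permutation.Setoid.Properties using (Unique-resp-↭)
open import Data.List.Relation.Unary.Unique.Propositional using (Unique)
import Data.List.Relation.Unary.Unique.Propositional.Properties as Unique
open import Data.Fin using (Fin; toℕ) renaming (zero to fzero; suc to fsuc)
open import Data.Product using (Σ; ∃; ∃₂; _×_; _,_; proj₁; proj₂)
open import Data.Sum using (_⊎_; inj₁; inj₂; [_,_]′) renaming (map to ⊎-map)
open import Data.Empty using (⊥-elim)
open import Function using (_∘_)
open import Function.Definitions using (Injective)
open import Relation.Nullary using (¬_; yes; no)
open import Relation.Binary.PropositionalEquality
  using (_≡_; _≢_; refl; sym; trans; cong; subst; subst₂; setoid; module ≡-Reasoning)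

private
  variable
    A B′ : Set
    a b c : A
    i j k m : ℕ
    w x y z z′ : List ℕ
    xs ys : List A

data Precedes {A : Set} : List A → A → A → Set where
  now   : a ∈ xs → Precedes (b ∷ xs) b a
  later : Precedes xs b a → Precedes (c ∷ xs) b a

Before⇒Precedes : Before x b a → Precedes x b a
Before⇒Precedes ([] , l₂ , l₃ , refl) = now (∈-++⁺ʳ l₂ (here refl))
Before⇒Precedes (c ∷ l₁ , l₂ , l₃ , refl) = later (Before⇒Precedes (l₁ , l₂ , l₃ , refl))

Precedes⇒Before : Precedes x b a → Before x b a
Precedes⇒Before (now a∈x) with l₂ , l₃ , refl ← ∈-∃++ a∈x = [] , l₂ , l₃ , refl
Precedes⇒Before (later {c = c} p) with l₁ , l₂ , l₃ , refl ← Precedes⇒Before p =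
  c ∷ l₁ , l₂ , l₃ , refl

Precedes-∈ˡ : Precedes xs b a → b ∈ xs
Precedes-∈ˡ (now _) = here refl
Precedes-∈ˡ (later p) = there (Precedes-∈ˡ p)

Precedes-∈ʳ : Precedes xs b a → a ∈ xs
Precedes-∈ʳ (now a∈xs) = there a∈xs
Precedes-∈ʳ (later p) = there (Precedes-∈ʳ p)

Precedes-++⁺ˡ : ∀ ys → Precedes xs b a → Precedes (xs ++ ys) b a
Precedes-++⁺ˡ ys (now a∈xs) = now (∈-++⁺ˡ a∈xs)
Precedes-++⁺ˡ ys (later p) = later (Precedes-++⁺ˡ ys p)

Precedes-++⁻ : ∀ xs → Precedes (xs ++ ys) b a → Precedes xs b a ⊎ (b ∈ xs × a ∈ ys) ⊎ Precedes ys b a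
Precedes-++⁻ [] p = inj₂ (inj₂ p)
Precedes-++⁻ (c ∷ xs) (now a∈) with ∈-++⁻ xs a∈
... | inj₁ a∈xs = inj₁ (now a∈xs)
... | inj₂ a∈ys = inj₂ (inj₁ (here refl , a∈ys))
Precedes-++⁻ (c ∷ xs) (later p) with Precedes-++⁻ xs p
... | inj₁ q = inj₁ (later q)
... | inj₂ (inj₁ (b∈xs , a∈ys)) = inj₂ (inj₁ (there b∈xs , a∈ys))
... | inj₂ (inj₂ q) = inj₂ (inj₂ q)

Precedes-[_] : ∀ (c : A) → ¬ Precedes [ c ] b a
Precedes-[ c ] (now ())
Precedes-[ c ] (later ())

Precedes-map⁺ : ∀ (f : A → B′) → Precedes xs b a → Precedes (map f xs) (f b) (f a)
Precedes-map⁺ f (now a∈xs) = now (∈-map⁺ f a∈xs)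
Precedes-map⁺ f (later p) = later (Precedes-map⁺ f p)

Precedes-map⁻ : ∀ (f : A → B′) {b a} → Precedes (map f xs) b a →
                ∃₂ λ b′ a′ → b ≡ f b′ × a ≡ f a′ × Precedes xs b′ a′
Precedes-map⁻ {xs = c ∷ xs} f (now a∈) with a′ , a′∈xs , refl ← ∈-map⁻ f a∈ =
  c , a′ , refl , refl , now a′∈xs
Precedes-map⁻ {xs = c ∷ xs} f (later p) with b′ , a′ , refl , refl , q ← Precedes-map⁻ f p =
  b′ , a′ , refl , refl , later q

≤W-Precedes : x ≤W y → a < b → Precedes x b a → Precedes y b a
≤W-Precedes le a<b = Before⇒Precedes ∘ le _ _ a<b ∘ Precedes⇒Before

Precedes⇒≤W : (∀ {a b} → a < b → Precedes x b a → Precedes y b a) → x ≤W y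
Precedes⇒≤W h a b a<b = Precedes⇒Before ∘ h a<b ∘ Before⇒Precedes

≤W-∷⁻ : (c ∷ x) ≤W y → x ≤W y
≤W-∷⁻ le = Precedes⇒≤W λ a<b → ≤W-Precedes le a<b ∘ later

≤W-first : (∀ {c} → c ∈ x → a ≢ c → a < c) → (∀ {b} → ¬ Precedes y b a) →
           x ≤W y → a ∈ x → ∃ λ r → x ≡ a ∷ r
≤W-first {x = c ∷ r} min free le (here refl) = r , refl
≤W-first {x = c ∷ r} {a = a} min free le (there a∈r) with a ≟ c
... | yes refl = r , refl
... | no a≢c = ⊥-elim (free (≤W-Precedes le (min (here refl) a≢c) (now a∈r)))

∈-∷⁻ : a ≢ c → a ∈ c ∷ xs → a ∈ xs
∈-∷⁻ a≢c (here a≡c) = ⊥-elim (a≢c a≡c)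
∈-∷⁻ a≢c (there a∈xs) = a∈xs

Unique-adjacent : ∀ (p : List A) {q} → Unique (p ++ a ∷ b ∷ q) → a ≢ b
Unique-adjacent [] ((a≢b ∷ _) ∷ _) = a≢b
Unique-adjacent (c ∷ p) (_ ∷ u) = Unique-adjacent p u

≤W-last : Unique x → (∀ {c} → c ∈ x → c ≢ b → c < b) → (∀ {a} → ¬ Precedes y b a) →
          x ≤W y → b ∈ x → ∃ λ p → x ≡ p ++ [ b ]
≤W-last u max free le b∈x with ∈-∃++ b∈x
... | p , [] , refl = p , refl
... | p , c ∷ q , refl =
  ⊥-elim (free (≤W-Precedes le (max (∈-++⁺ʳ p (there (here refl))) (Unique-adjacent p u ∘ sym))
                                  (Before⇒Precedes (p , [] , q , refl))))

data _[_]=_ {A : Set} : List A → ℕ → A → Set where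
  at-head : (a ∷ xs) [ 0 ]= a
  at-tail : xs [ i ]= a → (c ∷ xs) [ suc i ]= a

lookup⇒[]= : ∀ (xs : List A) (k : Fin (length xs)) → xs [ toℕ k ]= lookup xs k
lookup⇒[]= (c ∷ xs) fzero = at-head
lookup⇒[]= (c ∷ xs) (fsuc k) = at-tail (lookup⇒[]= xs k)

[]=⇒lookup : xs [ i ]= a → Σ (Fin (length xs)) λ k → toℕ k ≡ i × lookup xs k ≡ a
[]=⇒lookup at-head = fzero , refl , refl
[]=⇒lookup (at-tail p) with k , refl , refl ← []=⇒lookup p = fsuc k , refl , refl

[]=⇒< : xs [ i ]= a → i < length xs
[]=⇒< at-head = s≤s z≤n
[]=⇒< (at-tail p) = s≤s ([]=⇒< p)

[]=-map⁺ : ∀ (f : A → B′) → xs [ i ]= a → map f xs [ i ]= f a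
[]=-map⁺ f at-head = at-head
[]=-map⁺ f (at-tail p) = at-tail ([]=-map⁺ f p)

[]=-map⁻ : ∀ (f : A → B′) {b} → map f xs [ i ]= b → ∃ λ a → b ≡ f a × xs [ i ]= a
[]=-map⁻ {xs = c ∷ xs} f at-head = c , refl , at-head
[]=-map⁻ {xs = c ∷ xs} f (at-tail p) with a , refl , q ← []=-map⁻ f p = a , refl , at-tail q

[]=-++⁺ˡ : ∀ ys → xs [ i ]= a → (xs ++ ys) [ i ]= a
[]=-++⁺ˡ ys at-head = at-head
[]=-++⁺ˡ ys (at-tail p) = at-tail ([]=-++⁺ˡ ys p)

[]=-++⁻ : ∀ xs → (xs ++ ys) [ i ]= a → xs [ i ]= a ⊎ ∃ λ j → i ≡ length xs + j × ys [ j ]= a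
[]=-++⁻ [] p = inj₂ (_ , refl , p)
[]=-++⁻ (c ∷ xs) at-head = inj₁ at-head
[]=-++⁻ (c ∷ xs) (at-tail p) with []=-++⁻ xs p
... | inj₁ q = inj₁ (at-tail q)
... | inj₂ (j , refl , q) = inj₂ (j , refl , q)

[]=-[_] : ∀ (c : A) → [ c ] [ i ]= a → i ≡ 0 × a ≡ c
[]=-[ c ] at-head = refl , refl

LookupAntipodal : ℕ → List ℕ → Set
LookupAntipodal m x =
  ∀ (i j : Fin (length x)) → toℕ i + toℕ j + 1 ≡ 2 * m → lookup x i + lookup x j ≡ 2 * m + 1

Antipodal : ℕ → List ℕ → Set
Antipodal m x = ∀ {i j a b} → x [ i ]= a → x [ j ]= b → i + j + 1 ≡ 2 * m → a + b ≡ 2 * m + 1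

LookupAntipodal⇒Antipodal : LookupAntipodal m x → Antipodal m x
LookupAntipodal⇒Antipodal s p q eq with []=⇒lookup p | []=⇒lookup q
... | k , refl , refl | k′ , refl , refl = s k k′ eq

Antipodal⇒LookupAntipodal : Antipodal m x → LookupAntipodal m x
Antipodal⇒LookupAntipodal {x = x} s i j = s (lookup⇒[]= x i) (lookup⇒[]= x j)

InRange : ℕ → List ℕ → Set
InRange k z = ∀ {v} → v ∈ z → 1 ≤ v × v ≤ k

IsPerm⇒InRange : IsPerm k z → InRange k z
IsPerm⇒InRange p v∈z with u , u∈ , refl ← ∈-map⁻ suc (∈-resp-↭ p v∈z) = s≤s z≤n , ∈-upTo⁻ u∈

IsPerm⇒length : IsPerm k z → length z ≡ k
IsPerm⇒length {k} p = trans (↭-length p) (trans (length-map suc (upTo k)) (length-upTo k))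

IsPerm⇒Unique : IsPerm k z → Unique z
IsPerm⇒Unique {k} p =
  Unique-resp-↭ (setoid ℕ) (↭⇒↭ₛ (↭-sym p)) (Unique.map⁺ suc-injective (Unique.upTo⁺ k))

map-suc-upTo-suc-suc : ∀ k → map suc (upTo (suc (suc k))) ≡ 1 ∷ map suc (map suc (upTo k)) ++ [ suc (suc k) ]
map-suc-upTo-suc-suc k = cong (1 ∷_) (begin
  map suc (applyUpTo suc (suc k))          ≡⟨ cong (map suc) (sym (map-upTo suc (suc k))) ⟩
  map suc (map suc (upTo (suc k)))         ≡⟨ cong (map suc ∘ map suc) (sym (upTo-∷ʳ k)) ⟩
  map suc (map suc (upTo k ++ [ k ]))      ≡⟨ cong (map suc) (map-++ suc (upTo k) [ k ]) ⟩
  map suc (map suc (upTo k) ++ [ suc k ])  ≡⟨ map-++ suc (map suc (upTo k)) [ suc k ] ⟩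
  map suc (map suc (upTo k)) ++ [ suc (suc k) ] ∎)
  where open ≡-Reasoning

↭-map⁻ : ∀ {f : A → B′} → Injective _≡_ _≡_ f → map f xs ↭ map f ys → xs ↭ ys
↭-map⁻ {f = f} f-inj p with ys′ , eq , q ← ↭-map-inv f (↭-sym p) =
  ↭-sym (subst (_ ↭_) (sym (map-injective f-inj eq)) q)

B⇒InRange : B m z → InRange (2 * m) z
B⇒InRange = IsPerm⇒InRange ∘ proj₁

positive⇒map-suc : (∀ {v} → v ∈ z → 1 ≤ v) → ∃ λ z′ → z ≡ map suc z′
positive⇒map-suc {[]} _ = [] , refl
positive⇒map-suc {zero ∷ z} pos with () ← pos (here refl)
positive⇒map-suc {suc v ∷ z} pos with z′ , refl ← positive⇒map-suc (pos ∘ there) = v ∷ z′ , refl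

-- The embedding of B_m into B_{m+1}

embed : ℕ → List ℕ → List ℕ
embed m z = 1 ∷ map suc z ++ [ 2 * suc m ]

2*suc≢1 : ∀ m → 2 * suc m ≢ 1
2*suc≢1 m = m+1+n≢0 m ∘ suc-injective

0∉map-suc : ¬ 0 ∈ map suc z
0∉map-suc 0∈ with _ , _ , () ← ∈-map⁻ suc 0∈

1∉map-suc : InRange k z → ¬ 1 ∈ map suc z
1∉map-suc r 1∈ with _ , u∈ , refl ← ∈-map⁻ suc 1∈ with () ← proj₁ (r u∈)

map-suc-< : InRange (2 * m) z → c ∈ map suc z → c < 2 * suc m
map-suc-< {m} r c∈ with u , u∈ , refl ← ∈-map⁻ suc c∈ =
  subst (suc u <_) (sym (*-suc 2 m)) (s≤s (s≤s (proj₂ (r u∈))))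

embed-Precedes⁻ : InRange (2 * m) z → a < b → Precedes (embed m z) b a →
                  ∃₂ λ b′ a′ → b ≡ suc b′ × a ≡ suc a′ × Precedes z b′ a′
embed-Precedes⁻ {z = z} r (s≤s z≤n) (now 0∈) =
  ⊥-elim ([ 0∉map-suc , (λ { (here ()) }) ]′ (∈-++⁻ (map suc z) 0∈))
embed-Precedes⁻ {z = z} r a<b (later p) with Precedes-++⁻ (map suc z) p
... | inj₁ q = Precedes-map⁻ suc q
... | inj₂ (inj₁ (b∈ , here refl)) = ⊥-elim (<-asym a<b (map-suc-< r b∈))
... | inj₂ (inj₂ q) = ⊥-elim (Precedes-[ _ ] q)

embed-mono : InRange (2 * m) z → z ≤W z′ → embed m z ≤W embed m z′
embed-mono {m} {z} {z′} r le = Precedes⇒≤W lift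
  where
  lift : a < b → Precedes (embed m z) b a → Precedes (embed m z′) b a
  lift a<b p with _ , _ , refl , refl , q ← embed-Precedes⁻ r a<b p =
    later (Precedes-++⁺ˡ _ (Precedes-map⁺ suc (≤W-Precedes le (≤-pred a<b) q)))

embed-reflects : InRange (2 * m) z′ → embed m z ≤W embed m z′ → z ≤W z′
embed-reflects {m} {z′} {z} r le = Precedes⇒≤W reflect
  where
  reflect : a < b → Precedes z b a → Precedes z′ b a
  reflect a<b p with _ , _ , refl , refl , q ←
    embed-Precedes⁻ r (s≤s a<b) (≤W-Precedes le (s≤s a<b) (later (Precedes-++⁺ˡ _ (Precedes-map⁺ suc p))))
    = q

embed-injective : embed m z ≡ embed m z′ → z ≡ z′
embed-injective {m} {z} {z′} eq =
  map-injective suc-injective (++-cancelʳ [ 2 * suc m ] (map suc z) (map suc z′) (∷-injectiveʳ eq))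

map-suc-upTo-2*suc : ∀ m → map suc (upTo (2 * suc m)) ≡ embed m (map suc (upTo (2 * m)))
map-suc-upTo-2*suc m =
  subst (λ k → map suc (upTo k) ≡ 1 ∷ map suc (map suc (upTo (2 * m))) ++ [ k ])
        (sym (*-suc 2 m)) (map-suc-upTo-suc-suc (2 * m))

IsPerm-embed : IsPerm (2 * m) z → IsPerm (2 * suc m) (embed m z)
IsPerm-embed {m} {z} p = subst (embed m z ↭_) (sym (map-suc-upTo-2*suc m)) (prep 1 (++⁺ʳ _ (map⁺ suc p)))

IsPerm-embed⁻ : IsPerm (2 * suc m) (embed m z) → IsPerm (2 * m) z
IsPerm-embed⁻ {m} {z} p = ↭-map⁻ suc-injective (subst₂ _↭_ (++-identityʳ _) (++-identityʳ _) inner)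
  where
  inner : map suc z ++ [] ↭ map suc (map suc (upTo (2 * m))) ++ []
  inner = drop-mid (map suc z) _ (drop-mid [] [] (subst (embed m z ↭_) (map-suc-upTo-2*suc m) p))

data EmbedPosition (m : ℕ) (z : List ℕ) : ℕ → ℕ → Set where
  first  : EmbedPosition m z 0 1
  middle : z [ i ]= a → EmbedPosition m z (suc i) (suc a)
  final  : i ≡ length z → EmbedPosition m z (suc i) (2 * suc m)

embed-position : embed m z [ i ]= a → EmbedPosition m z i a
embed-position at-head = first
embed-position {z = z} (at-tail p) with []=-++⁻ (map suc z) p
... | inj₁ q with _ , refl , r ← []=-map⁻ suc q = middle r
... | inj₂ (_ , refl , q) with refl , refl ← []=-[ _ ] q = final (trans (+-identityʳ _) (length-map suc z))

suc+suc : ∀ i j → suc i + suc j ≡ suc (suc (i + j))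
suc+suc i j = cong suc (+-suc i j)

embed-Antipodal : length z ≡ 2 * m → Antipodal m z → Antipodal (suc m) (embed m z)
embed-Antipodal {z} {m} len s p q eq =
  pair (embed-position p) (embed-position q) (trans (+-comm 1 _) (trans eq (*-suc 2 m)))
  where
  pair : EmbedPosition m z i a → EmbedPosition m z j b → suc (i + j) ≡ suc (suc (2 * m)) →
         a + b ≡ 2 * suc m + 1
  pair first first ()
  pair first (middle r) e = ⊥-elim (<-irrefl (suc-injective (suc-injective e)) (subst (_ <_) len ([]=⇒< r)))
  pair first (final _) _ = +-comm 1 _
  pair (middle {i} r) first e =
    ⊥-elim (<-irrefl (suc-injective (trans (sym (+-identityʳ (suc i))) (suc-injective e)))
                     (subst (_ <_) len ([]=⇒< r)))
  pair (middle {i} {u} r) (middle {j} {u′} r′) e = begin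
    suc u + suc u′       ≡⟨ suc+suc u u′ ⟩
    suc (suc (u + u′))   ≡⟨ cong (suc ∘ suc) (s r r′ i+j+1≡2m) ⟩
    suc (suc (2 * m + 1)) ≡⟨ cong (_+ 1) (*-suc 2 m) ⟨
    2 * suc m + 1        ∎
    where
    open ≡-Reasoning
    i+j+1≡2m : i + j + 1 ≡ 2 * m
    i+j+1≡2m = trans (+-comm (i + j) 1) (trans (sym (+-suc i j)) (suc-injective (suc-injective e)))
  pair (middle {i} _) (final l) e = ⊥-elim (m+1+n≢n i (trans (suc-injective (suc-injective e)) (sym (trans l len))))
  pair (final _) first _ = refl
  pair (final {L} l) (middle _) e = ⊥-elim (m+1+n≢m L (trans (suc-injective (suc-injective e)) (sym (trans l len))))
  pair (final {L} l) (final _) e = ⊥-elim (m+1+n≢m L (trans (suc-injective (suc-injective e)) (sym (trans l len))))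

embed-Antipodal⁻ : Antipodal (suc m) (embed m z) → Antipodal m z
embed-Antipodal⁻ {m} {z} s {i} {j} {a} {b} p q eq = suc-injective (suc-injective (begin
  suc (suc (a + b))  ≡⟨ suc+suc a b ⟨
  suc a + suc b      ≡⟨ s (shift p) (shift q) shifted-eq ⟩
  2 * suc m + 1      ≡⟨ cong (_+ 1) (*-suc 2 m) ⟩
  suc (suc (2 * m + 1)) ∎))
  where
  open ≡-Reasoning
  shift : z [ k ]= c → embed m z [ suc k ]= suc c
  shift = at-tail ∘ []=-++⁺ˡ _ ∘ []=-map⁺ suc
  shifted-eq : suc i + suc j + 1 ≡ 2 * suc m
  shifted-eq = trans (cong (_+ 1) (suc+suc i j)) (trans (cong (suc ∘ suc) eq) (sym (*-suc 2 m)))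

B-embed : B m z → B (suc m) (embed m z)
B-embed {m} (p , s) =
  IsPerm-embed p ,
  Antipodal⇒LookupAntipodal {suc m} (embed-Antipodal (IsPerm⇒length p) (LookupAntipodal⇒Antipodal {m} s))

B-embed⁻ : B (suc m) (embed m z) → B m z
B-embed⁻ {m} (p , s) =
  IsPerm-embed⁻ p , Antipodal⇒LookupAntipodal {m} (embed-Antipodal⁻ (LookupAntipodal⇒Antipodal {suc m} s))

-- The principal ideal of embed m w

1∉embed-tail : InRange (2 * m) w → ¬ 1 ∈ map suc w ++ [ 2 * suc m ]
1∉embed-tail {m} {w} r 1∈ =
  [ 1∉map-suc r , (λ { (here 1≡N) → 2*suc≢1 m (sym 1≡N) }) ]′ (∈-++⁻ (map suc w) 1∈)

embed-first-free : InRange (2 * m) w → ¬ Precedes (embed m w) b 1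
embed-first-free r (now 1∈) = 1∉embed-tail r 1∈
embed-first-free r (later p) = 1∉embed-tail r (Precedes-∈ʳ p)

embed-last-free : InRange (2 * m) w → Precedes (embed m w) b a → b ≢ 2 * suc m
embed-last-free {m} r (now _) = 2*suc≢1 m ∘ sym
embed-last-free {m} {w} r (later p) with Precedes-++⁻ (map suc w) p
... | inj₁ q = <⇒≢ (map-suc-< r (Precedes-∈ˡ q))
... | inj₂ (inj₁ (b∈ , _)) = <⇒≢ (map-suc-< r b∈)
... | inj₂ (inj₂ q) = ⊥-elim (Precedes-[ _ ] q)

B-suc⇒1∈ : B (suc m) z → 1 ∈ z
B-suc⇒1∈ {m} (p , _) = ∈-resp-↭ (↭-sym p) (subst (1 ∈_) (sym (map-suc-upTo-2*suc m)) (here refl))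

B-suc⇒2*suc∈ : B (suc m) z → 2 * suc m ∈ z
B-suc⇒2*suc∈ {m} (p , _) = ∈-resp-↭ (↭-sym p)
  (subst (2 * suc m ∈_) (sym (map-suc-upTo-2*suc m)) (there (∈-++⁺ʳ _ (here refl))))

≤W-embed⇒framed : InRange (2 * m) w → InRange (2 * suc m) z → Unique z → 1 ∈ z → 2 * suc m ∈ z →
                   z ≤W embed m w → ∃ λ q → z ≡ 1 ∷ q ++ [ 2 * suc m ]
≤W-embed⇒framed {m} rw rz unique 1∈z N∈z le
  with r , refl ← ≤W-first (λ c∈ → ≤∧≢⇒< (proj₁ (rz c∈))) (embed-first-free rw) le 1∈z
  with _ ∷ unique-r ← unique
  with q , refl ← ≤W-last unique-r (λ c∈ → ≤∧≢⇒< (proj₂ (rz (there c∈)))) (λ p → embed-last-free rw p refl)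
                          (≤W-∷⁻ le) (∈-∷⁻ (2*suc≢1 m) N∈z)
  = q , refl

≤W-embed⇒embed : B m w → B (suc m) z → z ≤W embed m w → ∃ λ z′ → z ≡ embed m z′ × B m z′
≤W-embed⇒embed {m} Bw Bz le
  with q , refl ← ≤W-embed⇒framed (B⇒InRange {m} Bw) (B⇒InRange {suc m} Bz) (IsPerm⇒Unique (proj₁ Bz))
                                   (B-suc⇒1∈ {m} Bz) (B-suc⇒2*suc∈ Bz) le
  with z′ , refl ← positive⇒map-suc {q} (λ v∈ → proj₁ (B⇒InRange {suc m} Bz (there (∈-++⁺ˡ v∈))))
  = z′ , refl , B-embed⁻ Bz

-- Covers and Pop along the embedding

module _ {m : ℕ} {w : List ℕ} (Bw : B m w) where

  embed-Covers⁻ : ∀ {s} → B m s → Covers (suc m) (embed m w) (embed m s) → Covers m w s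
  embed-Covers⁻ Bs (_ , _ , le , ≢ , between) =
    Bs , Bw , embed-reflects (B⇒InRange {m} Bw) le , ≢ ∘ cong (embed m) ,
    λ z Bz s≤z z≤w → ⊎-map embed-injective embed-injective
      (between (embed m z) (B-embed Bz) (embed-mono (B⇒InRange {m} Bs) s≤z) (embed-mono (B⇒InRange {m} Bz) z≤w))

  embed-Covers : ∀ {s} → Covers m w s → Covers (suc m) (embed m w) (embed m s)
  embed-Covers {s} (Bs , _ , le , ≢ , between) =
    B-embed Bs , B-embed Bw , embed-mono (B⇒InRange {m} Bs) le , ≢ ∘ embed-injective , between′
    where
    between′ : ∀ z → B (suc m) z → embed m s ≤W z → z ≤W embed m w → z ≡ embed m s ⊎ z ≡ embed m w
    between′ z Bz s≤z z≤w with z′ , refl , Bz′ ← ≤W-embed⇒embed Bw Bz z≤w =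
      ⊎-map (cong (embed m)) (cong (embed m))
        (between z′ Bz′ (embed-reflects (B⇒InRange {m} Bz′) s≤z) (embed-reflects (B⇒InRange {m} Bw) z≤w))

  embed-IsPopOf : ∀ {y} → IsPopOf m w y → IsPopOf (suc m) (embed m w) (embed m y)
  embed-IsPopOf {y} (By , lower , greatest) = B-embed By , lower′ , greatest′
    where
    lower′ : ∀ s → s ≡ embed m w ⊎ Covers (suc m) (embed m w) s → embed m y ≤W s
    lower′ s (inj₁ refl) = embed-mono (B⇒InRange {m} By) (lower w (inj₁ refl))
    lower′ s (inj₂ cover@(Bs , _ , s≤w , _)) with s′ , refl , Bs′ ← ≤W-embed⇒embed Bw Bs s≤w =
      embed-mono (B⇒InRange {m} By) (lower s′ (inj₂ (embed-Covers⁻ Bs′ cover)))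
    greatest′ : ∀ z → B (suc m) z → (∀ s → s ≡ embed m w ⊎ Covers (suc m) (embed m w) s → z ≤W s) →
                z ≤W embed m y
    greatest′ z Bz below with z′ , refl , Bz′ ← ≤W-embed⇒embed Bw Bz (below (embed m w) (inj₁ refl)) =
      embed-mono (B⇒InRange {m} Bz′) (greatest z′ Bz′ below′)
      where
      below′ : ∀ s → s ≡ w ⊎ Covers m w s → z′ ≤W s
      below′ s (inj₁ refl) = embed-reflects (B⇒InRange {m} Bw) (below (embed m w) (inj₁ refl))
      below′ s (inj₂ cover) =
        embed-reflects (B⇒InRange {m} (proj₁ cover)) (below (embed m s) (inj₂ (embed-Covers cover)))

mainTheorem4 : ∀ (n : ℕ) → 2 ≤ n → ∀ (y : List ℕ) → InPopImage (n ∸ 1) y →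
    InPopImage n (1 ∷ map suc y ++ (2 * n ∷ []))
mainTheorem4 (suc m) _ y (w , Bw , pop) = embed m w , B-embed Bw , embed-IsPopOf Bw pop
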